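{- Let $\Sigma$ be an alphabet with $|\Sigma|\geq 2$ and let $w\in\Sigma^*$. Then $w$ is a copy-word (i.e., $w=uu$ for some $u\in\Sigma^*$) if and only if, for all $a,b\in\Sigma$ with $a\neq b$, the word $h_{a,b}(w)$ is a copy-word.
   Context: For distinct $a,b\in\Sigma$, $h_{a,b}:\Sigma^*\to\{0,1\}^*$ is the monoid morphism with $a\mapsto 0$, $b\mapsto 1$ and $x\mapsto\lambda$ (empty word) for all other letters $x$. -}

module Defs where

open import Data.Nat using (ℕ)
open import Data.Fin using (Fin; _≟_)
open import Data.Bool using (Bool; true; false)
open import Data.List using (List; []; _∷_; _++_)
open import Data.Product using (∃-syntax)
open import Relation.Nullary using (yes; no)
open import Relation.Binary.PropositionalEquality using (_≡_)

IsCopy : {A : Set} → List A → Set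
IsCopy {A} w = ∃[ u ] (w ≡ u ++ u)

-- h_{a,b} : Σ* → {0,1}*, monoid morphism a ↦ 0 (false), b ↦ 1 (true),
-- every other letter ↦ empty word.  Alphabet Σ = Fin n.
h : {n : ℕ} → Fin n → Fin n → List (Fin n) → List Bool
h a b [] = []
h a b (x ∷ xs) with x ≟ a
... | yes _ = false ∷ h a b xs
... | no _ with x ≟ b
...   | yes _ = true ∷ h a b xs
...   | no _ = h a b xs

{-# OPTIONS --safe #-}
-- If every projection h_{a,b}(w) is a square x x, each letter occurs an even number of
-- times in w. Grow a prefix P of w letter by letter while no letter exceeds half of its
-- count in w. Unless w is empty, the growth stops before a letter e that has already
-- reached half; then every other letter a has reached half too, since otherwise the
-- image of P in h_{a,e}(w) = x x would contain all the 1s of x but not all its 0s, and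
-- yet be followed by a 1. So w = P Q where P holds exactly half of each letter, which
-- forces h_{a,b}(P) = x = h_{a,b}(Q) for all a ≠ b; as a word is determined by its
-- binary projections, P = Q.
module Submission where

open import Defs
open import Data.Nat using (ℕ; suc; _+_; _*_; _≤_; _<_; _≥_; z≤n; s≤s)
open import Data.Nat.Properties
  using ( suc-injective; +-comm; +-identityʳ; m≤m+n; ≤-antisym; ≤⇒≯; m≤n⇒m<n∨m≡n
        ; *-monoʳ-≤; *-cancelˡ-≡; *-cancelˡ-<; module ≤-Reasoning)
open import Data.Fin using (Fin; zero; suc; _≟_)
open import Data.Bool using (Bool; true; false)
import Data.Bool.Properties as Bool
open import Data.List using (List; []; _∷_; _++_; [_])
open import Data.List.Properties using (∷-injectiveˡ; ∷-injectiveʳ; ++-cancelˡ; ++-assoc; ++-identityʳ)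
open import Data.Product using (∃-syntax; ∃₂; _×_; _,_)
open import Data.Sum using (inj₁; inj₂)
open import Function.Bundles using (_⇔_; mk⇔)
open import Relation.Nullary using (¬_; yes; no; contradiction)
open import Relation.Binary.Definitions using (DecidableEquality)
open import Relation.Binary.PropositionalEquality
  using (_≡_; _≢_; refl; sym; trans; cong; subst; module ≡-Reasoning)

module _ {A : Set} (_≟ᴬ_ : DecidableEquality A) where

  count : A → List A → ℕ
  count a [] = 0
  count a (x ∷ xs) with x ≟ᴬ a
  ... | yes _ = suc (count a xs)
  ... | no _ = count a xs

  count-++ : ∀ a xs ys → count a (xs ++ ys) ≡ count a xs + count a ys
  count-++ a [] ys = refl
  count-++ a (x ∷ xs) ys with x ≟ᴬ a
  ... | yes _ = cong suc (count-++ a xs ys)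
  ... | no _ = count-++ a xs ys

  count-double : ∀ a xs → count a (xs ++ xs) ≡ 2 * count a xs
  count-double a xs = trans (count-++ a xs xs) (cong (count a xs +_) (sym (+-identityʳ _)))

zeros ones : List Bool → ℕ
zeros = count Bool._≟_ false
ones = count Bool._≟_ true

prefix-by-counts : ∀ s t x y → s ++ t ≡ x ++ y → zeros s ≡ zeros x → ones s ≡ ones x → s ≡ x
prefix-by-counts [] t [] y _ _ _ = refl
prefix-by-counts [] t (false ∷ x) y _ () _
prefix-by-counts [] t (true ∷ x) y _ _ ()
prefix-by-counts (false ∷ s) t [] y _ () _
prefix-by-counts (true ∷ s) t [] y _ _ ()
prefix-by-counts (false ∷ s) t (false ∷ x) y eq eq₀ eq₁ =
  cong (false ∷_) (prefix-by-counts s t x y (∷-injectiveʳ eq) (suc-injective eq₀) eq₁)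
prefix-by-counts (true ∷ s) t (true ∷ x) y eq eq₀ eq₁ =
  cong (true ∷_) (prefix-by-counts s t x y (∷-injectiveʳ eq) eq₀ (suc-injective eq₁))
prefix-by-counts (false ∷ s) t (true ∷ x) y eq _ _ = contradiction (∷-injectiveˡ eq) λ ()
prefix-by-counts (true ∷ s) t (false ∷ x) y eq _ _ = contradiction (∷-injectiveˡ eq) λ ()

copy-by-counts : ∀ s t x → s ++ t ≡ x ++ x → zeros s ≡ zeros x → ones s ≡ ones x → s ≡ t
copy-by-counts s t x eq eq₀ eq₁ = trans s≡x (sym t≡x)
  where
  s≡x : s ≡ x
  s≡x = prefix-by-counts s t x x eq eq₀ eq₁
  t≡x : t ≡ x
  t≡x = ++-cancelˡ x t x (subst (λ v → v ++ t ≡ x ++ x) s≡x eq)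

zeros≤-before-one : ∀ s t x y → s ++ true ∷ t ≡ x ++ y → ones s ≡ ones x → zeros x ≤ zeros s
zeros≤-before-one [] t [] y _ _ = z≤n
zeros≤-before-one [] t (false ∷ x) y eq _ = contradiction (∷-injectiveˡ eq) λ ()
zeros≤-before-one [] t (true ∷ x) y _ ()
zeros≤-before-one (_ ∷ s) t [] y _ _ = z≤n
zeros≤-before-one (false ∷ s) t (false ∷ x) y eq eq₁ =
  s≤s (zeros≤-before-one s t x y (∷-injectiveʳ eq) eq₁)
zeros≤-before-one (true ∷ s) t (true ∷ x) y eq eq₁ =
  zeros≤-before-one s t x y (∷-injectiveʳ eq) (suc-injective eq₁)
zeros≤-before-one (false ∷ s) t (true ∷ x) y eq _ = contradiction (∷-injectiveˡ eq) λ ()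
zeros≤-before-one (true ∷ s) t (false ∷ x) y eq _ = contradiction (∷-injectiveˡ eq) λ ()

occ : ∀ {n} → Fin n → List (Fin n) → ℕ
occ = count _≟_

module _ {n : ℕ} where

  h-++ : ∀ (a b : Fin n) xs ys → h a b (xs ++ ys) ≡ h a b xs ++ h a b ys
  h-++ a b [] ys = refl
  h-++ a b (x ∷ xs) ys with x ≟ a
  ... | yes _ = cong (false ∷_) (h-++ a b xs ys)
  ... | no _ with x ≟ b
  ...   | yes _ = cong (true ∷_) (h-++ a b xs ys)
  ...   | no _ = h-++ a b xs ys

  h-copy : ∀ (a b : Fin n) {w} → IsCopy w → IsCopy (h a b w)
  h-copy a b (u , refl) = h a b u , h-++ a b u u

  h-a∷ : ∀ (a b : Fin n) xs → h a b (a ∷ xs) ≡ false ∷ h a b xs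
  h-a∷ a b xs with a ≟ a
  ... | yes _ = refl
  ... | no a≢a = contradiction refl a≢a

  h-b∷ : ∀ {a b : Fin n} → a ≢ b → ∀ xs → h a b (b ∷ xs) ≡ true ∷ h a b xs
  h-b∷ {a} {b} a≢b xs with b ≟ a
  ... | yes b≡a = contradiction (sym b≡a) a≢b
  ... | no _ with b ≟ b
  ...   | yes _ = refl
  ...   | no b≢b = contradiction refl b≢b

  zeros-h : ∀ (a b : Fin n) w → zeros (h a b w) ≡ occ a w
  zeros-h a b [] = refl
  zeros-h a b (x ∷ w) with x ≟ a
  ... | yes _ = cong suc (zeros-h a b w)
  ... | no _ with x ≟ b
  ...   | yes _ = zeros-h a b w
  ...   | no _ = zeros-h a b w

  ones-h : ∀ {a b : Fin n} → a ≢ b → ∀ w → ones (h a b w) ≡ occ b w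
  ones-h a≢b [] = refl
  ones-h {a} {b} a≢b (x ∷ w) with x ≟ a
  ... | yes x≡a with x ≟ b
  ...   | yes x≡b = contradiction (trans (sym x≡a) x≡b) a≢b
  ...   | no _ = ones-h a≢b w
  ones-h {a} {b} a≢b (x ∷ w) | no _ with x ≟ b
  ...   | yes _ = cong suc (ones-h a≢b w)
  ...   | no _ = ones-h a≢b w

  occ≡2*zeros : ∀ (a b : Fin n) w x → h a b w ≡ x ++ x → occ a w ≡ 2 * zeros x
  occ≡2*zeros a b w x hw≡xx = begin
    occ a w          ≡⟨ sym (zeros-h a b w) ⟩
    zeros (h a b w)  ≡⟨ cong zeros hw≡xx ⟩
    zeros (x ++ x)   ≡⟨ count-double Bool._≟_ false x ⟩
    2 * zeros x      ∎
    where open ≡-Reasoning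

  occ≡2*ones : ∀ {a b : Fin n} → a ≢ b → ∀ w x → h a b w ≡ x ++ x → occ b w ≡ 2 * ones x
  occ≡2*ones {a} {b} a≢b w x hw≡xx = begin
    occ b w          ≡⟨ sym (ones-h a≢b w) ⟩
    ones (h a b w)   ≡⟨ cong ones hw≡xx ⟩
    ones (x ++ x)    ≡⟨ count-double Bool._≟_ true x ⟩
    2 * ones x       ∎
    where open ≡-Reasoning

  other-letter : n ≥ 2 → (x : Fin n) → ∃[ y ] x ≢ y
  other-letter (s≤s (s≤s _)) zero = suc zero , λ ()
  other-letter (s≤s (s≤s _)) (suc x) = zero , λ ()

  projections-injective : n ≥ 2 → ∀ P Q → (∀ a b → a ≢ b → h a b P ≡ h a b Q) → P ≡ Q
  projections-injective n≥2 [] [] _ = refl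
  projections-injective n≥2 [] (y ∷ Q) same with other-letter n≥2 y
  ... | b , y≢b = contradiction (trans (same y b y≢b) (h-a∷ y b Q)) λ ()
  projections-injective n≥2 (x ∷ P) [] same with other-letter n≥2 x
  ... | b , x≢b = contradiction (trans (sym (h-a∷ x b P)) (same x b x≢b)) λ ()
  projections-injective n≥2 (x ∷ P) (y ∷ Q) same with x ≟ y
  ... | no x≢y =
    contradiction (∷-injectiveˡ (trans (sym (h-a∷ x y P)) (trans (same x y x≢y) (h-b∷ x≢y Q)))) λ ()
  ... | yes refl = cong (x ∷_) (projections-injective n≥2 P Q same-tails)
    where
    same-tails : ∀ a b → a ≢ b → h a b P ≡ h a b Q
    same-tails a b a≢b = ++-cancelˡ (h a b [ x ]) _ _
      (trans (sym (h-++ a b [ x ] P)) (trans (same a b a≢b) (h-++ a b [ x ] Q)))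

  ProjectionsCopy : List (Fin n) → Set
  ProjectionsCopy w = ∀ a b → a ≢ b → IsCopy (h a b w)

  AtMostHalf Half : List (Fin n) → List (Fin n) → Set
  AtMostHalf P w = ∀ a → 2 * occ a P ≤ occ a w
  Half P w = ∀ a → 2 * occ a P ≡ occ a w

module CopyFromProjections {n : ℕ} (n≥2 : n ≥ 2) (w : List (Fin n)) (copies : ProjectionsCopy w) where

  occ-even : ∀ a → ∃[ k ] occ a w ≡ 2 * k
  occ-even a with other-letter n≥2 a
  ... | b , a≢b with copies a b a≢b
  ...   | x , hw≡xx = zeros x , occ≡2*zeros a b w x hw≡xx

  atMostHalf-whole : AtMostHalf w w → Half w w
  atMostHalf-whole below a = ≤-antisym (below a) (m≤m+n _ _)

  extend : ∀ P {e} → 2 * occ e P < occ e w → AtMostHalf P w → AtMostHalf (P ++ [ e ]) w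
  extend P {e} e-short below a rewrite count-++ _≟_ a P [ e ] with e ≟ a
  ... | no _ = subst (λ c → 2 * c ≤ occ a w) (sym (+-identityʳ (occ a P))) (below a)
  ... | yes refl with occ-even e
  ...   | k , e-even rewrite e-even =
    *-monoʳ-≤ 2 (subst (_≤ k) (+-comm 1 (occ e P)) (*-cancelˡ-< 2 _ _ e-short))

  balanced-at : ∀ P e R → w ≡ P ++ e ∷ R → 2 * occ e P ≡ occ e w → AtMostHalf P w → Half P w
  balanced-at P e R w≡ e-half below a with a ≟ e
  ... | yes refl = e-half
  ... | no a≢e with m≤n⇒m<n∨m≡n (below a) | copies a e a≢e
  ...   | inj₂ a-half | _ = a-half
  ...   | inj₁ a-short | x , hw≡xx = contradiction a-short (≤⇒≯ (begin
    occ a w               ≡⟨ occ≡2*zeros a e w x hw≡xx ⟩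
    2 * zeros x           ≤⟨ *-monoʳ-≤ 2 (subst (zeros x ≤_) (zeros-h a e P) zeros-bound) ⟩
    2 * occ a P           ∎))
    where
    open ≤-Reasoning
    split : h a e P ++ true ∷ h a e R ≡ x ++ x
    split = trans (cong (h a e P ++_) (sym (h-b∷ a≢e R)))
              (trans (sym (h-++ a e P (e ∷ R))) (trans (cong (h a e) (sym w≡)) hw≡xx))
    ones-match : ones (h a e P) ≡ ones x
    ones-match = trans (ones-h a≢e P)
      (*-cancelˡ-≡ _ _ 2 (trans e-half (occ≡2*ones a≢e w x hw≡xx)))
    zeros-bound : zeros x ≤ zeros (h a e P)
    zeros-bound = zeros≤-before-one (h a e P) (h a e R) x x split ones-match

  balanced-prefix : ∀ P R → w ≡ P ++ R → AtMostHalf P w → ∃₂ λ P Q → w ≡ P ++ Q × Half P w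
  balanced-prefix P [] w≡P++[] below =
    w , [] , sym (++-identityʳ w) , atMostHalf-whole (subst (λ v → AtMostHalf v w) P≡w below)
    where
    P≡w : P ≡ w
    P≡w = sym (trans w≡P++[] (++-identityʳ P))
  balanced-prefix P (e ∷ R) w≡ below with m≤n⇒m<n∨m≡n (below e)
  ... | inj₁ e-short =
    balanced-prefix (P ++ [ e ]) R (trans w≡ (sym (++-assoc P [ e ] R))) (extend P e-short below)
  ... | inj₂ e-half = P , e ∷ R , w≡ , balanced-at P e R w≡ e-half below

  halves-project-equal : ∀ P Q → w ≡ P ++ Q → Half P w → ∀ a b → a ≢ b → h a b P ≡ h a b Q
  halves-project-equal P Q w≡ half a b a≢b with copies a b a≢b
  ... | x , hw≡xx = copy-by-counts (h a b P) (h a b Q) x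
    (trans (sym (h-++ a b P Q)) (trans (cong (h a b) (sym w≡)) hw≡xx))
    (trans (zeros-h a b P) (*-cancelˡ-≡ _ _ 2 (trans (half a) (occ≡2*zeros a b w x hw≡xx))))
    (trans (ones-h a≢b P) (*-cancelˡ-≡ _ _ 2 (trans (half b) (occ≡2*ones a≢b w x hw≡xx))))

  isCopy : IsCopy w
  isCopy with balanced-prefix [] w refl (λ _ → z≤n)
  ... | P , Q , w≡P++Q , half = P , trans w≡P++Q (cong (P ++_) (sym P≡Q))
    where
    P≡Q : P ≡ Q
    P≡Q = projections-injective n≥2 P Q (halves-project-equal P Q w≡P++Q half)

mainTheorem16 : (n : ℕ) → n ≥ 2 → (w : List (Fin n)) →
    IsCopy w ⇔ (∀ (a b : Fin n) → ¬ (a ≡ b) → IsCopy (h a b w))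
mainTheorem16 n n≥2 w = mk⇔
  (λ w-copy a b _ → h-copy a b w-copy)
  (CopyFromProjections.isCopy n≥2 w)
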